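{- If $G$ is a connected graph of order $n \geq 4$ with $\gamma_R(G) = 4$, then $b_R(G) \leq \Delta(G) + \delta(G) - 1$.
   Context: All graphs are finite and simple. A Roman dominating function on $G$ is a function $f: V(G) \to \{0,1,2\}$ such that every vertex $v$ with $f(v)=0$ has a neighbor $u$ with $f(u)=2$; its weight is $\sum_v f(v)$, and $\gamma_R(G)$ is the minimum weight of such a function. $\Delta(G)$ and $\delta(G)$ are the maximum and minimum degrees. For a graph with maximum degree at least two, the Roman bondage number $b_R(G)$ is the minimum cardinality of a set $E' \subseteq E(G)$ with $\gamma_R(G - E') > \gamma_R(G)$, where $G-E'$ is obtained by deleting the edges of $E'$. -}

module Defs where

open import Data.Nat using (ℕ; zero; suc; _+_; _∸_; _≤_; _<_; _⊔_; _⊓_; _<ᵇ_)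
open import Data.Fin using (Fin; toℕ)
open import Data.List using (List; map; foldr; filter; length)
open import Data.Nat.ListAction using (sum)
open import Data.List using (allFin)
open import Data.Bool using (Bool; true; false; _∧_; not; T)
open import Data.Product using (Σ; _×_; ∃; ∃-syntax)
open import Relation.Binary.PropositionalEquality using (_≡_)

record Graph (n : ℕ) : Set where
  field
    adj   : Fin n → Fin n → Bool
    sym   : ∀ u v → adj u v ≡ adj v u
    irrefl : ∀ v → adj v v ≡ false
open Graph public

count : ∀ {n} → (Fin n → Bool) → ℕ
count {n} p = length (filter (λ j → T? (p j)) (allFin n))
  where
  open import Data.Bool.Properties using () renaming (T? to T?)

degree : ∀ {n} → Graph n → Fin n → ℕ
degree G v = count (adj G v)

maxDegree : ∀ {n} → Graph n → ℕ
maxDegree {n} G = foldr (λ v m → degree G v ⊔ m) 0 (allFin n)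

-- minimum degree δ(G); every degree is < n, so starting the fold at n is correct for n ≥ 1
minDegree : ∀ {n} → Graph n → ℕ
minDegree {n} G = foldr (λ v m → degree G v ⊓ m) n (allFin n)

data Reachable {n} (G : Graph n) : Fin n → Fin n → Set where
  here : ∀ {v} → Reachable G v v
  step : ∀ {u w v} → adj G u w ≡ true → Reachable G w v → Reachable G u v

Connected : ∀ {n} → Graph n → Set
Connected {n} G = ∀ (u v : Fin n) → Reachable G u v

weight : ∀ {n} → (Fin n → Fin 3) → ℕ
weight {n} f = sum (map (λ v → toℕ (f v)) (allFin n))

IsRDF : ∀ {n} → Graph n → (Fin n → Fin 3) → Set
IsRDF {n} G f = ∀ (v : Fin n) → toℕ (f v) ≡ 0 →
  ∃[ u ] (adj G v u ≡ true × toℕ (f u) ≡ 2)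

RomanDomNumber : ∀ {n} → Graph n → ℕ → Set
RomanDomNumber {n} G k =
  (∃[ f ] (IsRDF G f × weight f ≡ k)) ×
  (∀ (f : Fin n → Fin 3) → IsRDF G f → k ≤ weight f)

record EdgeSubset {n} (G : Graph n) : Set where
  field
    mem    : Fin n → Fin n → Bool
    memSym : ∀ u v → mem u v ≡ mem v u
    memSub : ∀ u v → mem u v ≡ true → adj G u v ≡ true
open EdgeSubset public

edgeCount : ∀ {n} {G : Graph n} → EdgeSubset G → ℕ
edgeCount {n} E = sum (map (λ i → count (λ j → (toℕ i <ᵇ toℕ j) ∧ mem E i j)) (allFin n))

deleteEdges : ∀ {n} (G : Graph n) → EdgeSubset G → Graph n
deleteEdges G E = record
  { adj = λ u v → adj G u v ∧ not (mem E u v)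
  ; sym = λ u v → lemma u v
  ; irrefl = λ v → lemma₂ v
  }
  where
  open import Relation.Binary.PropositionalEquality using (cong₂)
  lemma : ∀ u v → (adj G u v ∧ not (mem E u v)) ≡ (adj G v u ∧ not (mem E v u))
  lemma u v = cong₂ (λ a b → a ∧ not b) (sym G u v) (memSym E u v)
  lemma₂ : ∀ v → (adj G v v ∧ not (mem E v v)) ≡ false
  lemma₂ v with adj G v v | irrefl G v
  ... | false | _ = Relation.Binary.PropositionalEquality.refl
    where import Relation.Binary.PropositionalEquality

-- b_R(G) ≤ b : some edge set E' with |E'| ≤ b satisfies γ_R(G - E') > γ_R(G).
-- Here γ_R(G) is given as k; "γ_R(G - E') > k" means every RDF of G - E' has weight > k.
RomanBondageAtMost : ∀ {n} → Graph n → ℕ → ℕ → Set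
RomanBondageAtMost {n} G k b =
  Σ (EdgeSubset G) λ E → edgeCount E ≤ b ×
    (∀ (f : Fin n → Fin 3) → IsRDF (deleteEdges G E) f → k < weight f)

-- For every vertex x, putting 2 on x, 0 on its neighbours and 1 elsewhere is a Roman
-- dominating function of weight n + 1 - deg x, so γ_R(G) = 4 forces deg x ≤ n - 3; with
-- connectivity this also forces n ≥ 5.  Take v of minimum degree and a neighbour c, and delete
-- every edge at v or c except vc: then vc is a component, on which every RDF has weight ≥ 2.
-- On the remaining n - 2 ≥ 3 vertices an RDF of weight 2 must put its 2 on a vertex adjacent
-- to all the others (a dominator), so it suffices to delete also one edge inside the rest at
-- each dominator, which a star at one dominator x₁ achieves.  This costs one edge if x₁ is the
-- only dominator, and |D| - 1 edges for a set D of several dominators; then no dominator is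
-- adjacent to c (its degree would be n - 2), so deg c + |D| ≤ n - 1 ≤ deg x₁ + 2.  In all
-- cases the deleted edges number at most (deg v - 1) + Δ ≤ δ + Δ - 1, while every RDF of the
-- new graph has weight ≥ 5.

module Submission where

open import Defs hiding (sym)

open import Data.Bool using (Bool; true; false; _∧_; _∨_; not; if_then_else_)
open import Data.Bool.Properties
  using (T?; ∨-comm; ∨-zeroʳ; ∧-zeroʳ; not-injective; ¬-not) renaming (_≟_ to _≟ᵇ_)
open import Data.Empty using (⊥)
open import Data.Fin using (Fin; zero; suc; toℕ)
open import Data.Fin.Patterns using (0F; 1F; 2F)
open import Data.Fin.Properties using (_≟_; pigeonhole; ¬∀⟶∃¬; <-irrefl; all?; any?)
open import Data.List using (List; []; _∷_; map; filter; length; tabulate; foldr; allFin)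
open import Data.List.Membership.Propositional using (_∈_; _∉_; find)
open import Data.List.Membership.Propositional.Properties using (∈-allFin)
open import Data.List.Properties using (map-cong-local)
open import Data.List.Relation.Unary.All as All using (All; []; _∷_)
open import Data.List.Relation.Unary.All.Properties using (¬Any⇒All¬; ¬All⇒Any¬)
open import Data.List.Relation.Unary.Any using (here; there; index)
open import Data.List.Relation.Unary.Any.Properties using (lookup-index)
open import Data.List.Relation.Unary.Unique.Propositional using (Unique; []; _∷_)
open import Data.Nat using (ℕ; zero; suc; _+_; _∸_; _≤_; _<_; _⊔_; _⊓_; _<ᵇ_; z≤n; s≤s; s≤s⁻¹)
open import Data.Nat.ListAction using () renaming (sum to sumˡ)
open import Data.Nat.Properties
  using ( +-0-commutativeMonoid; +-commutativeSemigroup; +-comm; +-assoc; +-identityʳ; +-suc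
        ; +-mono-≤; +-monoˡ-≤; +-monoʳ-≤; +-cancelˡ-≤; +-cancelʳ-≤; m≤m+n; m≤n+m; m+n≤o⇒m≤o∸n
        ; m≤m⊔n; m≤n⊔m; ⊓-sel; ≤-refl; ≤-reflexive; ≤-trans; ≤-antisym; ≤∧≢⇒<; <⇒≤
        ; _≤?_; ≰⇒>; n<1⇒n≡0; module ≤-Reasoning )
  renaming (<-irrefl to ℕ-<-irrefl)
open import Algebra.Properties.CommutativeMonoid.Sum +-0-commutativeMonoid
  using (sum; sum-cong-≗; sum-replicate-zero; ∑-distrib-+; ∑-comm)
open import Algebra.Properties.CommutativeSemigroup +-commutativeSemigroup using (x∙yz≈y∙xz)
open import Data.Nat.Tactic.RingSolver using (solve-∀)
open import Data.Product using (∃-syntax; ∃₂; _×_; _,_; proj₁; proj₂)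
open import Data.Sum using (_⊎_; inj₁; inj₂; [_,_])
open import Function using (_∘_; case_of_)
open import Relation.Binary.PropositionalEquality hiding ([_])
open import Relation.Nullary using (Dec; does; yes; no; ¬_; ¬?; contradiction)
open import Relation.Nullary.Decidable
  using (dec-true; dec-false; decidable-stable; _⊎-dec_; _×-dec_; _→-dec_)
open import Relation.Unary using (Decidable)

-- Finite sums and counting over Fin n

witness : ∀ {A : Set} (a? : Dec A) → does a? ≡ true → A
witness (yes a) _ = a

∨-≡-true : ∀ {a b} → a ∨ b ≡ true → a ≡ true ⊎ b ≡ true
∨-≡-true {true}  _ = inj₁ refl
∨-≡-true {false} b = inj₂ b

χ : Bool → ℕ
χ true  = 1
χ false = 0

_without_ : ∀ {n} → (Fin n → ℕ) → Fin n → Fin n → ℕ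
(f without i) j = if does (j ≟ i) then 0 else f j

_∖_ : ∀ {n} → (Fin n → Bool) → Fin n → Fin n → Bool
(p ∖ i) j = p j ∧ not (does (j ≟ i))

∑-mono-≤ : ∀ {n} {f g : Fin n → ℕ} → (∀ i → f i ≤ g i) → sum f ≤ sum g
∑-mono-≤ {zero}  _   = z≤n
∑-mono-≤ {suc n} f≤g = +-mono-≤ (f≤g zero) (∑-mono-≤ (f≤g ∘ suc))

∑-one : ∀ n → sum {n} (λ _ → 1) ≡ n
∑-one zero    = refl
∑-one (suc n) = cong suc (∑-one n)

without-≢ : ∀ {n} (f : Fin n → ℕ) {i j} → j ≢ i → (f without i) j ≡ f j
without-≢ f {i} {j} j≢i with j ≟ i
... | yes j≡i = contradiction j≡i j≢i
... | no  _   = refl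

∑-without : ∀ {n} (f : Fin n → ℕ) i → sum f ≡ f i + sum (f without i)
∑-without f zero    = refl
∑-without f (suc i) = begin
  f zero + sum (f ∘ suc)                              ≡⟨ cong (f zero +_) (∑-without (f ∘ suc) i) ⟩
  f zero + (f (suc i) + sum ((f ∘ suc) without i))    ≡⟨ x∙yz≈y∙xz (f zero) (f (suc i)) _ ⟩
  f (suc i) + (f zero + sum ((f ∘ suc) without i))    ∎
  where
  open ≡-Reasoning

∑-distinct-≤ : ∀ {n} (f : Fin n → ℕ) {xs} → Unique xs → sumˡ (map f xs) ≤ sum f
∑-distinct-≤ f {[]}     []              = z≤n
∑-distinct-≤ f {x ∷ xs} (x≢xs ∷ uniq) = begin
  f x + sumˡ (map f xs)               ≡⟨ cong (λ ys → f x + sumˡ ys) (map-cong-local (All.map off-x x≢xs)) ⟩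
  f x + sumˡ (map (f without x) xs)   ≤⟨ +-monoʳ-≤ (f x) (∑-distinct-≤ (f without x) uniq) ⟩
  f x + sum (f without x)             ≡⟨ ∑-without f x ⟨
  sum f                               ∎
  where
  open ≤-Reasoning
  off-x : ∀ {y} → x ≢ y → f y ≡ (f without x) y
  off-x x≢y = sym (without-≢ f (x≢y ∘ sym))

sumˡ-map-tabulate : ∀ {n} {A : Set} (f : A → ℕ) (g : Fin n → A) → sumˡ (map f (tabulate g)) ≡ sum (f ∘ g)
sumˡ-map-tabulate {zero}  f g = refl
sumˡ-map-tabulate {suc n} f g = cong (f (g zero) +_) (sumˡ-map-tabulate f (g ∘ suc))

length-filter-tabulate : ∀ {n} {A : Set} (p : A → Bool) (g : Fin n → A) →
  length (filter (T? ∘ p) (tabulate g)) ≡ sum (χ ∘ p ∘ g)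
length-filter-tabulate {zero}  p g = refl
length-filter-tabulate {suc n} p g with p (g zero)
... | true  = cong suc (length-filter-tabulate p (g ∘ suc))
... | false = length-filter-tabulate p (g ∘ suc)

weight≡∑ : ∀ {n} (f : Fin n → Fin 3) → weight f ≡ sum (toℕ ∘ f)
weight≡∑ f = sumˡ-map-tabulate (toℕ ∘ f) (λ i → i)

count≡∑ : ∀ {n} (p : Fin n → Bool) → count p ≡ sum (χ ∘ p)
count≡∑ p = length-filter-tabulate p (λ i → i)

χ-mono : ∀ {a b} → (a ≡ true → b ≡ true) → χ a ≤ χ b
χ-mono {false} _   = z≤n
χ-mono {true}  a⇒b rewrite a⇒b refl = ≤-refl

χ-∨ : ∀ a b → χ (a ∨ b) ≤ χ a + χ b
χ-∨ true  _ = s≤s z≤n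
χ-∨ false _ = ≤-refl

χ-∨-disjoint : ∀ {a b} → (a ≡ true → b ≡ false) → χ (a ∨ b) ≡ χ a + χ b
χ-∨-disjoint {true}  a⇒¬b rewrite a⇒¬b refl = refl
χ-∨-disjoint {false} _    = refl

χ-not : ∀ a → χ a + χ (not a) ≡ 1
χ-not true  = refl
χ-not false = refl

module _ {n : ℕ} where

  count-false : count {n} (λ _ → false) ≡ 0
  count-false = trans (count≡∑ {n} (λ _ → false)) (sum-replicate-zero n)

  count-mono : {p q : Fin n → Bool} → (∀ j → p j ≡ true → q j ≡ true) → count p ≤ count q
  count-mono {p} {q} p⇒q =
    subst₂ _≤_ (sym (count≡∑ p)) (sym (count≡∑ q)) (∑-mono-≤ (λ j → χ-mono (p⇒q j)))

  count-∨ : (p q : Fin n → Bool) → count (λ j → p j ∨ q j) ≤ count p + count q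
  count-∨ p q = begin
    count (λ j → p j ∨ q j)       ≡⟨ count≡∑ (λ j → p j ∨ q j) ⟩
    sum (λ j → χ (p j ∨ q j))     ≤⟨ ∑-mono-≤ (λ j → χ-∨ (p j) (q j)) ⟩
    sum (λ j → χ (p j) + χ (q j)) ≡⟨ ∑-distrib-+ (χ ∘ p) (χ ∘ q) ⟩
    sum (χ ∘ p) + sum (χ ∘ q)     ≡⟨ cong₂ _+_ (count≡∑ p) (count≡∑ q) ⟨
    count p + count q             ∎
    where open ≤-Reasoning

  count-∨-disjoint : (p q : Fin n → Bool) → (∀ j → p j ≡ true → q j ≡ false) →
                     count (λ j → p j ∨ q j) ≡ count p + count q
  count-∨-disjoint p q disjoint = begin
    count (λ j → p j ∨ q j)       ≡⟨ count≡∑ (λ j → p j ∨ q j) ⟩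
    sum (λ j → χ (p j ∨ q j))     ≡⟨ sum-cong-≗ (λ j → χ-∨-disjoint (disjoint j)) ⟩
    sum (λ j → χ (p j) + χ (q j)) ≡⟨ ∑-distrib-+ (χ ∘ p) (χ ∘ q) ⟩
    sum (χ ∘ p) + sum (χ ∘ q)     ≡⟨ cong₂ _+_ (count≡∑ p) (count≡∑ q) ⟨
    count p + count q             ∎
    where open ≡-Reasoning

  count-complement : (p : Fin n → Bool) → count p + count (not ∘ p) ≡ n
  count-complement p = begin
    count p + count (not ∘ p)         ≡⟨ cong₂ _+_ (count≡∑ p) (count≡∑ (not ∘ p)) ⟩
    sum (χ ∘ p) + sum (χ ∘ not ∘ p)   ≡⟨ ∑-distrib-+ (χ ∘ p) (χ ∘ not ∘ p) ⟨
    sum (λ j → χ (p j) + χ (not (p j))) ≡⟨ sum-cong-≗ (χ-not ∘ p) ⟩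
    sum {n} (λ _ → 1)                 ≡⟨ ∑-one n ⟩
    n                                 ∎
    where open ≡-Reasoning

  count-split : (p : Fin n → Bool) (i : Fin n) → count p ≡ χ (p i) + count (p ∖ i)
  count-split p i = begin
    count p                           ≡⟨ count≡∑ p ⟩
    sum (χ ∘ p)                       ≡⟨ ∑-without (χ ∘ p) i ⟩
    χ (p i) + sum ((χ ∘ p) without i) ≡⟨ cong (χ (p i) +_) (sum-cong-≗ without≗∖) ⟩
    χ (p i) + sum (χ ∘ (p ∖ i))       ≡⟨ cong (χ (p i) +_) (count≡∑ (p ∖ i)) ⟨
    χ (p i) + count (p ∖ i)           ∎
    where
    open ≡-Reasoning
    without≗∖ : ∀ j → ((χ ∘ p) without i) j ≡ χ ((p ∖ i) j)
    without≗∖ j with does (j ≟ i) | p j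
    ... | true  | true  = refl
    ... | true  | false = refl
    ... | false | true  = refl
    ... | false | false = refl

  ∖-intro : {p : Fin n → Bool} {i j : Fin n} → p j ≡ true → j ≢ i → (p ∖ i) j ≡ true
  ∖-intro {i = i} {j} pj j≢i with j ≟ i
  ... | yes j≡i = contradiction j≡i j≢i
  ... | no  _   rewrite pj = refl

  ∖-elim : {p : Fin n → Bool} {i j : Fin n} → (p ∖ i) j ≡ true → p j ≡ true × j ≢ i
  ∖-elim {p} {i} {j} p∖ij with p j | j ≟ i
  ... | true | no j≢i = refl , j≢i

  count-∖ : (p : Fin n → Bool) {i : Fin n} → p i ≡ true → count (p ∖ i) + 1 ≡ count p
  count-∖ p {i} pi = begin
    count (p ∖ i) + 1        ≡⟨ +-comm (count (p ∖ i)) 1 ⟩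
    1 + count (p ∖ i)        ≡⟨ cong (λ b → χ b + count (p ∖ i)) pi ⟨
    χ (p i) + count (p ∖ i)  ≡⟨ count-split p i ⟨
    count p                  ∎
    where open ≡-Reasoning

  length≤count : (p : Fin n → Bool) {xs : List (Fin n)} →
                 Unique xs → All (λ j → p j ≡ true) xs → length xs ≤ count p
  length≤count p []                 []         = z≤n
  length≤count p {x ∷ xs} (x≢xs ∷ uniq) (px ∷ pxs) = begin
    suc (length xs)          ≤⟨ s≤s (length≤count (p ∖ x) uniq (All.zipWith p∖x (pxs , x≢xs))) ⟩
    suc (count (p ∖ x))      ≡⟨ cong (λ b → χ b + count (p ∖ x)) px ⟨
    χ (p x) + count (p ∖ x)  ≡⟨ count-split p x ⟨
    count p                  ∎
    where
    open ≤-Reasoning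
    p∖x : ∀ {y} → p y ≡ true × x ≢ y → (p ∖ x) y ≡ true
    p∖x (py , x≢y) = ∖-intro {p} py (x≢y ∘ sym)

  count≤length : (p : Fin n → Bool) (xs : List (Fin n)) →
                 (∀ j → p j ≡ true → j ∈ xs) → count p ≤ length xs
  count≤length p []       p⊆[] =
    ≤-trans (count-mono (λ j pj → contradiction (p⊆[] j pj) λ ())) (≤-reflexive count-false)
  count≤length p (x ∷ xs) p⊆x∷xs = begin
    count p                  ≡⟨ count-split p x ⟩
    χ (p x) + count (p ∖ x)  ≤⟨ +-mono-≤ (χ≤1 (p x)) (count≤length (p ∖ x) xs p∖x⊆xs) ⟩
    suc (length xs)          ∎
    where
    open ≤-Reasoning
    χ≤1 : ∀ b → χ b ≤ 1
    χ≤1 true  = ≤-refl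
    χ≤1 false = z≤n
    p∖x⊆xs : ∀ j → (p ∖ x) j ≡ true → j ∈ xs
    p∖x⊆xs j p∖xj with ∖-elim {p} p∖xj
    ... | pj , j≢x with p⊆x∷xs j pj
    ...   | here j≡x  = contradiction j≡x j≢x
    ...   | there j∈xs = j∈xs

  n≤count+length : (p : Fin n → Bool) (xs : List (Fin n)) →
                   (∀ j → p j ≡ false → j ∈ xs) → n ≤ count p + length xs
  n≤count+length p xs ¬p⊆xs = begin
    n                          ≡⟨ count-complement p ⟨
    count p + count (not ∘ p)  ≤⟨ +-monoʳ-≤ (count p) (count≤length (not ∘ p) xs ¬p⊆xs′) ⟩
    count p + length xs        ∎
    where
    open ≤-Reasoning
    ¬p⊆xs′ : ∀ j → not (p j) ≡ true → j ∈ xs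
    ¬p⊆xs′ j ¬pj = ¬p⊆xs j (not-injective ¬pj)

  ∃∉ : (xs : List (Fin n)) → length xs < n → ∃[ y ] y ∉ xs
  ∃∉ xs |xs|<n = ¬∀⟶∃¬ n (_∈ xs) (_∈? xs) ¬∀∈
    where
    open import Data.List.Membership.DecPropositional (_≟_ {n}) using (_∈?_)
    ¬∀∈ : ¬ (∀ y → y ∈ xs)
    ¬∀∈ ∀∈ with pigeonhole |xs|<n (λ y → index (∀∈ y))
    ... | i , j , i<j , same-index =
      <-irrefl (trans (lookup-index (∀∈ i))
                      (trans (cong (Data.List.lookup xs) same-index) (sym (lookup-index (∀∈ j)))))
               i<j

  fresh-list : (k : ℕ) (xs : List (Fin n)) → k + length xs ≤ n →
               ∃[ rs ] (Unique rs × All (_∉ xs) rs × length rs ≡ k)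
  fresh-list zero    xs _ = [] , [] , [] , refl
  fresh-list (suc k) xs k+1+|xs|≤n
    with y , y∉xs ← ∃∉ xs (≤-trans (s≤s (m≤n+m (length xs) k)) k+1+|xs|≤n)
    with rs , uniq , rs∉y∷xs , |rs|≡k
           ← fresh-list k (y ∷ xs) (subst (_≤ n) (sym (+-suc k (length xs))) k+1+|xs|≤n)
    = y ∷ rs , All.map (λ r∉y∷xs y≡r → r∉y∷xs (here (sym y≡r))) rs∉y∷xs ∷ uniq
             , y∉xs ∷ All.map (λ r∉y∷xs → r∉y∷xs ∘ there) rs∉y∷xs , cong suc |rs|≡k

  count≤n : (p : Fin n → Bool) → count p ≤ n
  count≤n p = subst (count p ≤_) (count-complement p) (m≤m+n (count p) _)

  count-≟ : (i : Fin n) → count (λ j → does (j ≟ i)) ≡ 1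
  count-≟ i = ≤-antisym
    (count≤length (λ j → does (j ≟ i)) (i ∷ []) (λ j j≟i → here (witness (j ≟ i) j≟i)))
    (length≤count (λ j → does (j ≟ i)) {i ∷ []} ([] ∷ []) (dec-true (i ≟ i) refl ∷ []))

  count<n : (p : Fin n → Bool) {i : Fin n} → p i ≡ false → count p < n
  count<n p {i} pi≡false = begin
    suc (count p)              ≡⟨ +-comm 1 (count p) ⟩
    count p + 1                ≤⟨ +-monoʳ-≤ (count p) 1≤count-not-p ⟩
    count p + count (not ∘ p)  ≡⟨ count-complement p ⟩
    n                          ∎
    where
    open ≤-Reasoning
    1≤count-not-p : 1 ≤ count (not ∘ p)
    1≤count-not-p = length≤count (not ∘ p) {i ∷ []} ([] ∷ []) (cong not pi≡false ∷ [])

χ-∧-∨ : ∀ l a b → χ (l ∧ (a ∨ b)) ≤ χ (l ∧ a) + χ (l ∧ b)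
χ-∧-∨ true  a b = χ-∨ a b
χ-∧-∨ false a b = z≤n

χ-∧-exclusive : ∀ {a b} q → (a ≡ true → b ≡ false) → χ (a ∧ q) + χ (b ∧ q) ≤ χ q
χ-∧-exclusive {true}  q a⇒¬b rewrite a⇒¬b refl = ≤-reflexive (+-identityʳ (χ q))
χ-∧-exclusive {false} {true}  q _ = ≤-refl
χ-∧-exclusive {false} {false} q _ = z≤n

<ᵇ-asym : ∀ m n → (m <ᵇ n) ≡ true → (n <ᵇ m) ≡ false
<ᵇ-asym zero    (suc n) _   = refl
<ᵇ-asym (suc m) (suc n) m<n = <ᵇ-asym m n m<n

module _ {n : ℕ} where

  ∑∑-distrib-+ : (f g : Fin n → Fin n → ℕ) →
                 sum (λ i → sum (λ j → f i j + g i j)) ≡ sum (λ i → sum (f i)) + sum (λ i → sum (g i))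
  ∑∑-distrib-+ f g =
    trans (sum-cong-≗ (λ i → ∑-distrib-+ (f i) (g i))) (∑-distrib-+ (λ i → sum (f i)) (λ i → sum (g i)))

  ∑-count-∨ : (Q R : Fin n → Fin n → Bool) →
              sum (λ i → count (λ j → Q i j ∨ R i j)) ≤ sum (λ i → count (Q i)) + sum (λ i → count (R i))
  ∑-count-∨ Q R = ≤-trans (∑-mono-≤ (λ i → count-∨ (Q i) (R i)))
                          (≤-reflexive (∑-distrib-+ (λ i → count (Q i)) (λ i → count (R i))))

  star : Fin n → (Fin n → Bool) → Fin n → Fin n → Bool
  star a S i j = does (i ≟ a) ∧ S j

  star-centre : ∀ {a : Fin n} {S : Fin n → Bool} {j} → S j ≡ true → star a S a j ≡ true
  star-centre {a} Sj rewrite dec-true (a ≟ a) refl = Sj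

  ∑-count-star : (a : Fin n) (S : Fin n → Bool) → sum (λ i → count (star a S i)) ≡ count S
  ∑-count-star a S = begin
    sum (λ i → count (star a S i))                        ≡⟨ ∑-without _ a ⟩
    count (star a S a) + sum ((λ i → count (star a S i)) without a)
                                                          ≡⟨ cong₂ _+_ centre (sum-cong-≗ elsewhere) ⟩
    count S + sum {n} (λ _ → 0)                           ≡⟨ cong (count S +_) (sum-replicate-zero n) ⟩
    count S + 0                                           ≡⟨ +-identityʳ (count S) ⟩
    count S                                               ∎
    where
    open ≡-Reasoning
    centre : count (star a S a) ≡ count S
    centre rewrite dec-true (a ≟ a) refl = refl
    elsewhere : ∀ i → ((λ i → count (star a S i)) without a) i ≡ 0
    elsewhere i with i ≟ a
    ... | yes _ = refl
    ... | no  _ = count-false {n}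

  -- A pair i < j is counted once on the left, and on the right in row i or row j according to
  -- the direction in which Q relates it.
  ∑-count-symmetrise : (Q : Fin n → Fin n → Bool) →
    sum (λ i → count (λ j → (toℕ i <ᵇ toℕ j) ∧ (Q i j ∨ Q j i))) ≤ sum (λ i → count (Q i))
  ∑-count-symmetrise Q = begin
    sum (λ i → count (λ j → lt i j ∧ (Q i j ∨ Q j i)))
      ≡⟨ sum-cong-≗ (λ i → count≡∑ (λ j → lt i j ∧ (Q i j ∨ Q j i))) ⟩
    sum (λ i → sum (λ j → χ (lt i j ∧ (Q i j ∨ Q j i))))
      ≤⟨ ∑-mono-≤ (λ i → ∑-mono-≤ (λ j → χ-∧-∨ (lt i j) (Q i j) (Q j i))) ⟩
    sum (λ i → sum (λ j → χ (lt i j ∧ Q i j) + χ (lt i j ∧ Q j i)))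
      ≡⟨ ∑∑-distrib-+ (λ i j → χ (lt i j ∧ Q i j)) (λ i j → χ (lt i j ∧ Q j i)) ⟩
    sum (λ i → sum (λ j → χ (lt i j ∧ Q i j))) + sum (λ i → sum (λ j → χ (lt i j ∧ Q j i)))
      ≡⟨ cong (sum (λ i → sum (λ j → χ (lt i j ∧ Q i j))) +_) (∑-comm (λ i j → χ (lt i j ∧ Q j i))) ⟩
    sum (λ i → sum (λ j → χ (lt i j ∧ Q i j))) + sum (λ i → sum (λ j → χ (lt j i ∧ Q i j)))
      ≡⟨ ∑∑-distrib-+ (λ i j → χ (lt i j ∧ Q i j)) (λ i j → χ (lt j i ∧ Q i j)) ⟨
    sum (λ i → sum (λ j → χ (lt i j ∧ Q i j) + χ (lt j i ∧ Q i j)))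
      ≤⟨ ∑-mono-≤ (λ i → ∑-mono-≤ (λ j → χ-∧-exclusive (Q i j) (<ᵇ-asym (toℕ i) (toℕ j)))) ⟩
    sum (λ i → sum (χ ∘ Q i))
      ≡⟨ sum-cong-≗ (λ i → count≡∑ (Q i)) ⟨
    sum (λ i → count (Q i))
      ∎
    where
    open ≤-Reasoning
    lt : Fin n → Fin n → Bool
    lt i j = toℕ i <ᵇ toℕ j

foldr-⊔-≥ : ∀ {A : Set} (g : A → ℕ) {x xs} → x ∈ xs → g x ≤ foldr (λ y m → g y ⊔ m) 0 xs
foldr-⊔-≥ g (here refl)  = m≤m⊔n _ _
foldr-⊔-≥ g (there x∈xs) = ≤-trans (foldr-⊔-≥ g x∈xs) (m≤n⊔m _ _)

foldr-⊓-attained : ∀ {A : Set} (g : A → ℕ) {b} (xs : List A) →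
                   ∃[ x ] g x ≤ b → ∃[ x ] g x ≤ foldr (λ y m → g y ⊓ m) b xs
foldr-⊓-attained g []       below = below
foldr-⊓-attained g {b} (y ∷ ys) below with ⊓-sel (g y) (foldr (λ y m → g y ⊓ m) b ys)
... | inj₁ min≡gy = y , ≤-reflexive (sym min≡gy)
... | inj₂ min≡rest with foldr-⊓-attained g ys below
...   | x , gx≤rest = x , ≤-trans gx≤rest (≤-reflexive (sym min≡rest))

-- Degrees, connectivity and edge deletion

module _ {n : ℕ} (G : Graph n) where

  degree≤maxDegree : ∀ v → degree G v ≤ maxDegree G
  degree≤maxDegree v = foldr-⊔-≥ (degree G) (∈-allFin v)

  minDegree-attained : Fin n → ∃[ v ] degree G v ≤ minDegree G
  minDegree-attained v = foldr-⊓-attained (degree G) (allFin n) (v , count≤n (adj G v))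

  adj-sym : ∀ {u w} → adj G u w ≡ true → adj G w u ≡ true
  adj-sym {u} {w} uw = trans (Graph.sym G w u) uw

  adj⇒≢ : ∀ {u w} → adj G u w ≡ true → u ≢ w
  adj⇒≢ {u} uu refl = case trans (sym uu) (irrefl G u) of λ ()

  2≤degree : ∀ {a p q} → adj G a p ≡ true → adj G a q ≡ true → p ≢ q → 2 ≤ degree G a
  2≤degree {a} {p} {q} ap aq p≢q =
    length≤count (adj G a) {p ∷ q ∷ []} ((p≢q ∷ []) ∷ [] ∷ []) (ap ∷ aq ∷ [])

  path-exits : {S : Fin n → Set} → Decidable S → ∀ {a b} → Reachable G a b → S a → ¬ S b →
               ∃₂ λ x y → S x × ¬ S y × adj G x y ≡ true
  path-exits S? here                 Sa ¬Sb = contradiction Sa ¬Sb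
  path-exits S? (step {w = w} aw wb) Sa ¬Sb with S? w
  ... | yes Sw  = path-exits S? wb Sw ¬Sb
  ... | no  ¬Sw = _ , w , Sa , ¬Sw , aw

  ∃-neighbour : 2 ≤ n → Connected G → ∀ v → ∃[ c ] adj G v c ≡ true
  ∃-neighbour 2≤n connected v with ∃∉ (v ∷ []) 2≤n
  ... | u , u∉[v] with path-exits (_≟ v) (connected v u) refl (u∉[v] ∘ here)
  ...   | _ , c , refl , _ , vc = c , vc

  connected⇒∃2≤degree : 3 ≤ n → Connected G → ∃[ a ] 2 ≤ degree G a
  connected⇒∃2≤degree 3≤n connected
    with v , _       ← ∃∉ [] (≤-trans (s≤s z≤n) 3≤n)
    with c , vc      ← ∃-neighbour (≤-trans (s≤s (s≤s z≤n)) 3≤n) connected v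
    with w , w∉[v,c] ← ∃∉ (v ∷ c ∷ []) 3≤n
    with w≢v ∷ w≢c ∷ [] ← ¬Any⇒All¬ _ w∉[v,c]
    with path-exits (λ x → (x ≟ v) ⊎-dec (x ≟ c)) (connected v w) (inj₁ refl) [ w≢v , w≢c ]
  ... | _ , y , inj₁ refl , y∉ , vy = v , 2≤degree vc vy (λ c≡y → y∉ (inj₂ (sym c≡y)))
  ... | _ , y , inj₂ refl , y∉ , cy = c , 2≤degree (adj-sym vc) cy (λ v≡y → y∉ (inj₁ (sym v≡y)))

  sparse-connected⇒5≤n : 4 ≤ n → Connected G → (∀ x → degree G x + 3 ≤ n) → 5 ≤ n
  sparse-connected⇒5≤n 4≤n connected sparse = ≤∧≢⇒< 4≤n λ 4≡n →
    let a , 2≤deg = connected⇒∃2≤degree (<⇒≤ 4≤n) connected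
    in  ℕ-<-irrefl refl (subst (5 ≤_) (sym 4≡n) (≤-trans (+-monoˡ-≤ 3 2≤deg) (sparse a)))

  starRDF : Fin n → Fin n → Fin 3
  starRDF x u = if does (u ≟ x) then 2F else if adj G x u then 0F else 1F

  starRDF-centre : ∀ x → toℕ (starRDF x x) ≡ 2
  starRDF-centre x rewrite dec-true (x ≟ x) refl = refl

  starRDF-isRDF : ∀ x → IsRDF G (starRDF x)
  starRDF-isRDF x u fu≡0 with u ≟ x | adj G x u in xu
  ... | no _ | true = x , adj-sym xu , starRDF-centre x

  weight-starRDF : ∀ x → weight (starRDF x) + degree G x ≡ suc n
  weight-starRDF x = begin
    weight (starRDF x) + degree G x
      ≡⟨ cong₂ _+_ (weight≡∑ (starRDF x)) (count≡∑ (adj G x)) ⟩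
    sum (toℕ ∘ starRDF x) + sum (χ ∘ adj G x)
      ≡⟨ ∑-distrib-+ (toℕ ∘ starRDF x) (χ ∘ adj G x) ⟨
    sum (λ u → toℕ (starRDF x u) + χ (adj G x u))
      ≡⟨ sum-cong-≗ pointwise ⟩
    sum (λ u → 1 + χ (does (u ≟ x)))
      ≡⟨ ∑-distrib-+ (λ _ → 1) (λ u → χ (does (u ≟ x))) ⟩
    sum {n} (λ _ → 1) + sum (λ u → χ (does (u ≟ x)))
      ≡⟨ cong₂ _+_ (∑-one n) (trans (sym (count≡∑ (λ u → does (u ≟ x)))) (count-≟ x)) ⟩
    n + 1
      ≡⟨ +-comm n 1 ⟩
    suc n
      ∎
    where
    open ≡-Reasoning
    pointwise : ∀ u → toℕ (starRDF x u) + χ (adj G x u) ≡ 1 + χ (does (u ≟ x))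
    pointwise u with u ≟ x
    ... | yes refl rewrite irrefl G x = refl
    ... | no _ with adj G x u
    ...   | true  = refl
    ...   | false = refl

  γR+degree≤n+1 : ∀ {k} → RomanDomNumber G k → ∀ x → k + degree G x ≤ suc n
  γR+degree≤n+1 {k} (_ , minimal) x = subst (k + degree G x ≤_) (weight-starRDF x)
    (+-monoˡ-≤ (degree G x) (minimal (starRDF x) (starRDF-isRDF x)))

  symClosure : (Q : Fin n → Fin n → Bool) → (∀ i j → Q i j ≡ true → adj G i j ≡ true) → EdgeSubset G
  symClosure Q Q⊆adj = record
    { mem    = λ i j → Q i j ∨ Q j i
    ; memSym = λ i j → ∨-comm (Q i j) (Q j i)
    ; memSub = λ i j → [ Q⊆adj i j , adj-sym ∘ Q⊆adj j i ] ∘ ∨-≡-true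
    }

  edgeCount-symClosure : (Q : Fin n → Fin n → Bool) (Q⊆adj : ∀ i j → Q i j ≡ true → adj G i j ≡ true) →
                         edgeCount (symClosure Q Q⊆adj) ≤ sum (λ i → count (Q i))
  edgeCount-symClosure Q Q⊆adj =
    subst (_≤ sum (λ i → count (Q i)))
          (sym (sumˡ-map-tabulate (λ i → count (λ j → (toℕ i <ᵇ toℕ j) ∧ (Q i j ∨ Q j i))) (λ i → i)))
          (∑-count-symmetrise Q)

  deleteEdges-adj : (E : EdgeSubset G) → ∀ {u w} → adj (deleteEdges G E) u w ≡ true →
                    adj G u w ≡ true × mem E u w ≡ false
  deleteEdges-adj E {u} {w} uw with adj G u w | mem E u w
  ... | true | false = refl , refl

  deleteEdges-nonadj : (E : EdgeSubset G) → ∀ {u w} → adj G u w ≡ false →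
                       adj (deleteEdges G E) u w ≡ false
  deleteEdges-nonadj E uw rewrite uw = refl

  deleteEdges-deleted : (E : EdgeSubset G) → ∀ {u w} → mem E u w ≡ true →
                        adj (deleteEdges G E) u w ≡ false
  deleteEdges-deleted E {u} {w} uw∈E rewrite uw∈E = ∧-zeroʳ (adj G u w)

-- Lower bounds on the weight of Roman dominating functions

length≤sumˡ : ∀ {A : Set} (g : A → ℕ) {xs} → All (λ x → 1 ≤ g x) xs → length xs ≤ sumˡ (map g xs)
length≤sumˡ g []         = z≤n
length≤sumˡ g (gx ∷ gxs) = +-mono-≤ gx (length≤sumˡ g gxs)

module _ {n : ℕ} (f : Fin n → Fin 3) where

  WeighsOn : (Fin n → Set) → ℕ → Set
  WeighsOn R k = ∃[ rs ] (Unique rs × All R rs × k ≤ sumˡ (map (toℕ ∘ f) rs))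

  weight-from-parts : ∀ {v c} {R : Fin n → Set} → v ≢ c → (∀ {r} → R r → r ≢ v × r ≢ c) →
                      2 ≤ toℕ (f v) + toℕ (f c) → WeighsOn R 3 → 4 < weight f
  weight-from-parts {v} {c} v≢c R⇒≢ 2≤fv+fc (rs , uniq , Rrs , 3≤∑rs) = begin
    5                                     ≤⟨ +-mono-≤ 2≤fv+fc 3≤∑rs ⟩
    (g v + g c) + sumˡ (map g rs)         ≡⟨ +-assoc (g v) (g c) _ ⟩
    sumˡ (map g (v ∷ c ∷ rs))             ≤⟨ ∑-distinct-≤ g v∷c∷rs-unique ⟩
    sum g                                 ≡⟨ weight≡∑ f ⟨
    weight f                              ∎
    where
    open ≤-Reasoning
    g = toℕ ∘ f
    v∷c∷rs-unique : Unique (v ∷ c ∷ rs)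
    v∷c∷rs-unique = (v≢c ∷ All.map (λ Rr → proj₁ (R⇒≢ Rr) ∘ sym) Rrs)
                  ∷ All.map (λ Rr → proj₂ (R⇒≢ Rr) ∘ sym) Rrs ∷ uniq

module _ {n : ℕ} (H : Graph n) (f : Fin n → Fin 3) (rdf : IsRDF H f) where

  isolatedEdge-weight : ∀ {v c} → (∀ w → adj H v w ≡ true → w ≡ c) → (∀ w → adj H c w ≡ true → w ≡ v) →
                        2 ≤ toℕ (f v) + toℕ (f c)
  isolatedEdge-weight {v} {c} only-c only-v with toℕ (f v) in fv
  ... | zero with rdf v fv
  ...   | w , vw , fw≡2 with refl ← only-c w vw = ≤-reflexive (sym fw≡2)
  isolatedEdge-weight {v} {c} only-c only-v | suc a with toℕ (f c) in fc
  ...   | suc b = s≤s (≤-trans (s≤s z≤n) (m≤n+m (suc b) a))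
  ...   | zero with rdf c fc
  ...     | w , cw , fw≡2 with refl ← only-v w cw =
    ≤-reflexive (sym (trans (+-identityʳ (suc a)) (trans (sym fv) fw≡2)))

  module _ (R : Fin n → Set) (R-closed : ∀ {y w} → R y → adj H y w ≡ true → R w)
           (undominated : ∀ {x} → R x → ∃[ z ] (R z × z ≢ x × adj H x z ≡ false)) where

    -- A vertex y with f y = 0 has a neighbour x with f x = 2; some z ∈ R is not adjacent to x,
    -- and either f z ≥ 1 or z has its own neighbour w ≠ x with f w = 2.
    undominated-zero : ∀ {y} → R y → toℕ (f y) ≡ 0 → WeighsOn f R 3
    undominated-zero Ry fy≡0
      with x , yx , fx≡2 ← rdf _ fy≡0
      with Rx ← R-closed Ry yx
      with z , Rz , z≢x , ¬xz ← undominated Rx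
      with toℕ (f z) in fz
    ... | suc k = x ∷ z ∷ [] , ((z≢x ∘ sym) ∷ []) ∷ [] ∷ [] , Rx ∷ Rz ∷ [] ,
                  subst₂ (λ a b → 3 ≤ a + (b + 0)) (sym fx≡2) (sym fz) (s≤s (s≤s (s≤s z≤n)))
    ... | zero with w , zw , fw≡2 ← rdf z fz =
                  x ∷ w ∷ [] , (x≢w ∷ []) ∷ [] ∷ [] , Rx ∷ R-closed Rz zw ∷ [] ,
                  subst₂ (λ a b → 3 ≤ a + (b + 0)) (sym fx≡2) (sym fw≡2) (s≤s (s≤s (s≤s z≤n)))
      where
      x≢w : x ≢ w
      x≢w refl = case trans (sym ¬xz) (adj-sym H zw) of λ ()

    undominated-weight : ∃[ rs ] (Unique rs × All R rs × 3 ≤ length rs) → WeighsOn f R 3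
    undominated-weight (rs , uniq , Rrs , 3≤|rs|) with All.all? (λ r → 1 ≤? toℕ (f r)) rs
    ... | yes positive = rs , uniq , Rrs , ≤-trans 3≤|rs| (length≤sumˡ (toℕ ∘ f) positive)
    ... | no ¬positive with r , r∈rs , fr≱1 ← find (¬All⇒Any¬ (λ r → 1 ≤? toℕ (f r)) rs ¬positive) =
      undominated-zero (All.lookup Rrs r∈rs) (n<1⇒n≡0 (≰⇒> fr≱1))

-- Isolating an edge

module IsolateEdge {n : ℕ} (G : Graph n) {v c : Fin n} (vc : adj G v c ≡ true) where

  Outside : Fin n → Set
  Outside x = x ≢ v × x ≢ c

  Dominates : Fin n → Set
  Dominates x = ∀ z → Outside z → z ≢ x → adj G x z ≡ true

  outside? : Decidable Outside
  outside? x = ¬? (x ≟ v) ×-dec ¬? (x ≟ c)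

  dominates-at? : ∀ x → Decidable (λ z → Outside z → z ≢ x → adj G x z ≡ true)
  dominates-at? x z = outside? z →-dec (¬? (z ≟ x) →-dec (adj G x z ≟ᵇ true))

  dominates? : Decidable Dominates
  dominates? x = all? (dominates-at? x)

  dominator? : Decidable (λ x → Outside x × Dominates x)
  dominator? x = outside? x ×-dec dominates? x

  ∉[v,c]⇒Outside : ∀ {r} → r ∉ v ∷ c ∷ [] → Outside r
  ∉[v,c]⇒Outside r∉ with r≢v ∷ r≢c ∷ [] ← ¬Any⇒All¬ _ r∉ = r≢v , r≢c

  three-outside : 5 ≤ n → ∃[ rs ] (Unique rs × All Outside rs × 3 ≤ length rs)
  three-outside 5≤n = outside (fresh-list 3 (v ∷ c ∷ []) 5≤n)
    where
    outside : ∃[ rs ] (Unique rs × All (_∉ v ∷ c ∷ []) rs × length rs ≡ 3) →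
              ∃[ rs ] (Unique rs × All Outside rs × 3 ≤ length rs)
    outside (rs , uniq , rs∉[v,c] , |rs|≡3) =
      rs , uniq , All.map ∉[v,c]⇒Outside rs∉[v,c] , ≤-reflexive (sym |rs|≡3)

  Δ+δ-1 : ℕ
  Δ+δ-1 = maxDegree G + minDegree G ∸ 1

  N[v]∖c N[c]∖v : Fin n → Bool
  N[v]∖c = adj G v ∖ c
  N[c]∖v = adj G c ∖ v

  Covers : Fin n → (Fin n → Bool) → Set
  Covers x₁ T = ∀ {x} → Outside x → Dominates x →
                ∃[ z ] (Outside z × ((x ≡ x₁ × T z ≡ true) ⊎ (z ≡ x₁ × T x ≡ true)))

  module _ (x₁ : Fin n) (T : Fin n → Bool) (T⊆N[x₁] : ∀ j → T j ≡ true → adj G x₁ j ≡ true) where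

    cut : Fin n → Fin n → Bool
    cut i j = star v N[v]∖c i j ∨ (star c N[c]∖v i j ∨ star x₁ T i j)

    cut⊆adj : ∀ i j → cut i j ≡ true → adj G i j ≡ true
    cut⊆adj i j =
      [ star⊆adj (λ _ → proj₁ ∘ ∖-elim {p = adj G v})
      , [ star⊆adj (λ _ → proj₁ ∘ ∖-elim {p = adj G c}) , star⊆adj T⊆N[x₁] ] ∘ ∨-≡-true
      ] ∘ ∨-≡-true
      where
      star⊆adj : ∀ {a S} → (∀ j → S j ≡ true → adj G a j ≡ true) →
                 star a S i j ≡ true → adj G i j ≡ true
      star⊆adj {a} S⊆N[a] aj with i ≟ a
      ... | yes refl = S⊆N[a] j aj

    E : EdgeSubset G
    E = symClosure G cut cut⊆adj

    H : Graph n
    H = deleteEdges G E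

    edgeCount-E : edgeCount E ≤ count N[v]∖c + (count N[c]∖v + count T)
    edgeCount-E = begin
      edgeCount E
        ≤⟨ edgeCount-symClosure G cut cut⊆adj ⟩
      sum (λ i → count (cut i))
        ≤⟨ ∑-count-∨ (star v N[v]∖c) (λ i j → star c N[c]∖v i j ∨ star x₁ T i j) ⟩
      ∑ₛ v N[v]∖c + sum (λ i → count (λ j → star c N[c]∖v i j ∨ star x₁ T i j))
        ≤⟨ +-monoʳ-≤ (∑ₛ v N[v]∖c) (∑-count-∨ (star c N[c]∖v) (star x₁ T)) ⟩
      ∑ₛ v N[v]∖c + (∑ₛ c N[c]∖v + ∑ₛ x₁ T)
        ≡⟨ cong₂ _+_ (∑-count-star v N[v]∖c) (cong₂ _+_ (∑-count-star c N[c]∖v) (∑-count-star x₁ T)) ⟩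
      count N[v]∖c + (count N[c]∖v + count T)
        ∎
      where
      open ≤-Reasoning
      ∑ₛ : Fin n → (Fin n → Bool) → ℕ
      ∑ₛ a S = sum (λ i → count (star a S i))

    cut-v : ∀ {j} → N[v]∖c j ≡ true → cut v j ≡ true
    cut-v {j} Sj =
      cong (_∨ (star c N[c]∖v v j ∨ star x₁ T v j)) (star-centre {a = v} {S = N[v]∖c} {j = j} Sj)

    cut-c : ∀ {j} → N[c]∖v j ≡ true → cut c j ≡ true
    cut-c {j} Sj = trans
      (cong (λ b → star v N[v]∖c c j ∨ (b ∨ star x₁ T c j)) (star-centre {a = c} {S = N[c]∖v} {j = j} Sj))
      (∨-zeroʳ (star v N[v]∖c c j))

    cut-x₁ : ∀ {j} → T j ≡ true → cut x₁ j ≡ true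
    cut-x₁ {j} Sj = trans
      (cong (λ b → star v N[v]∖c x₁ j ∨ (star c N[c]∖v x₁ j ∨ b)) (star-centre {a = x₁} {S = T} {j = j} Sj))
      (trans (cong (star v N[v]∖c x₁ j ∨_) (∨-zeroʳ (star c N[c]∖v x₁ j))) (∨-zeroʳ (star v N[v]∖c x₁ j)))

    H⊆G : ∀ {i j} → adj H i j ≡ true → adj G i j ≡ true
    H⊆G = proj₁ ∘ deleteEdges-adj G E

    uncut : ∀ {i j} → adj H i j ≡ true → cut i j ≡ true → ⊥
    uncut {i} {j} ij cut-ij = case trans (sym (proj₂ (deleteEdges-adj G E ij))) in-E of λ ()
      where
      in-E : mem E i j ≡ true
      in-E rewrite cut-ij = refl

    severed : ∀ {i j} → cut i j ≡ true → adj H i j ≡ false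
    severed {i} {j} cut-ij = deleteEdges-deleted G E (subst (λ b → b ∨ cut j i ≡ true) (sym cut-ij) refl)

    severedᵀ : ∀ {i j} → cut j i ≡ true → adj H i j ≡ false
    severedᵀ {i} {j} cut-ji = trans (Graph.sym H i j) (severed cut-ji)

    H-only-c : ∀ w → adj H v w ≡ true → w ≡ c
    H-only-c w vw = case w ≟ c of λ where
      (yes w≡c) → w≡c
      (no  w≢c) → contradiction (cut-v (∖-intro {p = adj G v} (H⊆G {v} vw) w≢c)) (uncut {v} vw)

    H-only-v : ∀ w → adj H c w ≡ true → w ≡ v
    H-only-v w cw = case w ≟ v of λ where
      (yes w≡v) → w≡v
      (no  w≢v) → contradiction (cut-c (∖-intro {p = adj G c} (H⊆G {c} cw) w≢v)) (uncut {c} cw)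

    H-closed : ∀ {y w} → Outside y → adj H y w ≡ true → Outside w
    H-closed {y} (y≢v , y≢c) yw = w≢v , w≢c
      where
      wy = trans (Graph.sym H _ y) yw
      w≢v : _ ≢ v
      w≢v refl = uncut {v} wy (cut-v (∖-intro {p = adj G v} (H⊆G {v} wy) y≢c))
      w≢c : _ ≢ c
      w≢c refl = uncut {c} wy (cut-c (∖-intro {p = adj G c} (H⊆G {c} wy) y≢v))

    module _ (covers : Covers x₁ T) where

      H-undominated : ∀ {x} → Outside x → ∃[ z ] (Outside z × z ≢ x × adj H x z ≡ false)
      H-undominated {x} Ox with dominates? x
      ... | yes dom with covers Ox dom
      ...   | z , Oz , inj₁ (refl , Tz) = z , Oz , adj⇒≢ G (T⊆N[x₁] z Tz) ∘ sym , severed (cut-x₁ Tz)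
      ...   | z , Oz , inj₂ (refl , Tx) = z , Oz , adj⇒≢ G (T⊆N[x₁] x Tx) , severedᵀ (cut-x₁ Tx)
      H-undominated {x} Ox | no ¬dom with z , ¬dom-z ← ¬∀⟶∃¬ n _ (dominates-at? x) ¬dom =
        z , (z≢v , z≢c) , z≢x , deleteEdges-nonadj G E (¬-not (λ xz → ¬dom-z (λ _ _ → xz)))
        where
        z≢v : z ≢ v
        z≢v z≡v = ¬dom-z (λ Oz → contradiction z≡v (proj₁ Oz))
        z≢c : z ≢ c
        z≢c z≡c = ¬dom-z (λ Oz → contradiction z≡c (proj₂ Oz))
        z≢x : z ≢ x
        z≢x z≡x = ¬dom-z (λ _ z≢x → contradiction z≡x z≢x)

      cut-weight : 5 ≤ n → ∀ f → IsRDF H f → 4 < weight f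
      cut-weight 5≤n f rdf = weight-from-parts f {v} {c} {Outside} (adj⇒≢ G vc) (λ Or → Or) pair rest
        where
        pair : 2 ≤ toℕ (f v) + toℕ (f c)
        pair = isolatedEdge-weight H f rdf {v} {c} H-only-c H-only-v
        rest : WeighsOn f Outside 3
        rest = undominated-weight H f rdf Outside H-closed H-undominated (three-outside 5≤n)

      cut-bondage : 5 ≤ n → degree G v ≤ minDegree G → count N[c]∖v + count T ≤ maxDegree G →
                    RomanBondageAtMost G 4 Δ+δ-1
      cut-bondage 5≤n v-min budget = E , m+n≤o⇒m≤o∸n (edgeCount E) edgeCount+1≤Δ+δ , cut-weight 5≤n
        where
        edgeCount+1≤Δ+δ : edgeCount E + 1 ≤ maxDegree G + minDegree G
        edgeCount+1≤Δ+δ = begin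
          edgeCount E + 1            ≤⟨ +-monoˡ-≤ 1 edgeCount-E ⟩
          |A| + (|B| + |T|) + 1      ≡⟨ +-assoc |A| (|B| + |T|) 1 ⟩
          |A| + ((|B| + |T|) + 1)    ≡⟨ x∙yz≈y∙xz |A| (|B| + |T|) 1 ⟩
          (|B| + |T|) + (|A| + 1)    ≤⟨ +-mono-≤ budget (≤-trans (≤-reflexive (count-∖ (adj G v) vc)) v-min) ⟩
          maxDegree G + minDegree G  ∎
          where
          open ≤-Reasoning
          |A| |B| |T| : ℕ
          |A| = count N[v]∖c
          |B| = count N[c]∖v
          |T| = count T

  n≤degree+3 : ∀ {x} → Dominates x → n ≤ degree G x + 3
  n≤degree+3 {x} dom = n≤count+length (adj G x) (v ∷ c ∷ x ∷ []) non-neighbour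
    where
    non-neighbour : ∀ z → adj G x z ≡ false → z ∈ v ∷ c ∷ x ∷ []
    non-neighbour z xz with z ≟ v | z ≟ c | z ≟ x
    ... | yes z≡v | _       | _       = here z≡v
    ... | no _    | yes z≡c | _       = there (here z≡c)
    ... | no _    | no _    | yes z≡x = there (there (here z≡x))
    ... | no z≢v  | no z≢c  | no z≢x  = case trans (sym xz) (dom z (z≢v , z≢c) z≢x) of λ ()

  module _ (sparse : ∀ x → degree G x + 3 ≤ n) (5≤n : 5 ≤ n) (v-min : degree G v ≤ minDegree G) where

    dominator-≁-c : ∀ {x} → Dominates x → adj G c x ≡ false
    dominator-≁-c {x} dom = ¬-not λ cx → 3≰2 (+-cancelˡ-≤ (degree G x) 3 2
      (≤-trans (sparse x) (n≤count+length (adj G x) (v ∷ x ∷ []) (non-neighbour cx))))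
      where
      3≰2 : ¬ 3 ≤ 2
      3≰2 (s≤s (s≤s ()))
      non-neighbour : adj G c x ≡ true → ∀ z → adj G x z ≡ false → z ∈ v ∷ x ∷ []
      non-neighbour cx z xz with z ≟ v | z ≟ c | z ≟ x
      ... | yes z≡v | _       | _       = here z≡v
      ... | no _    | _       | yes z≡x = there (here z≡x)
      ... | no _    | yes refl | no _   = case trans (sym xz) (adj-sym G cx) of λ ()
      ... | no z≢v  | no z≢c  | no z≢x  = case trans (sym xz) (dom z (z≢v , z≢c) z≢x) of λ ()

    |N[c]∖v|+1≤Δ : count N[c]∖v + 1 ≤ maxDegree G
    |N[c]∖v|+1≤Δ = ≤-trans (≤-reflexive (count-∖ (adj G c) (adj-sym G vc))) (degree≤maxDegree G c)

    bondage-without-dominator : (∀ {x} → Outside x → ¬ Dominates x) → RomanBondageAtMost G 4 Δ+δ-1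
    bondage-without-dominator none =
      cut-bondage v (λ _ → false) (λ _ ()) (λ Ox dom → contradiction dom (none Ox)) 5≤n v-min budget
      where
      budget : count N[c]∖v + count {n} (λ _ → false) ≤ maxDegree G
      budget = subst (λ k → count N[c]∖v + k ≤ maxDegree G) (sym (count-false {n}))
                     (≤-trans (+-monoʳ-≤ (count N[c]∖v) z≤n) |N[c]∖v|+1≤Δ)

    bondage-with-unique-dominator : ∀ {x₁} → Outside x₁ → Dominates x₁ →
                                    (∀ {x} → Outside x → Dominates x → x ≡ x₁) → RomanBondageAtMost G 4 Δ+δ-1
    bondage-with-unique-dominator {x₁} O₁ dom₁ unique
      with y , y∉ ← ∃∉ (v ∷ c ∷ x₁ ∷ []) (<⇒≤ 5≤n)
      with y≢v ∷ y≢c ∷ y≢x₁ ∷ [] ← ¬Any⇒All¬ _ y∉ =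
      cut-bondage x₁ (λ j → does (j ≟ y)) ≟y⊆N[x₁] covers 5≤n v-min budget
      where
      ≟y⊆N[x₁] : ∀ j → does (j ≟ y) ≡ true → adj G x₁ j ≡ true
      ≟y⊆N[x₁] j j≟y with refl ← witness (j ≟ y) j≟y = dom₁ j (y≢v , y≢c) y≢x₁
      covers : Covers x₁ (λ j → does (j ≟ y))
      covers Ox dom = y , (y≢v , y≢c) , inj₁ (unique Ox dom , dec-true (y ≟ y) refl)
      budget : count N[c]∖v + count (λ j → does (j ≟ y)) ≤ maxDegree G
      budget = subst (λ k → count N[c]∖v + k ≤ maxDegree G) (sym (count-≟ y)) |N[c]∖v|+1≤Δ

    bondage-with-two-dominators : ∀ {x₁ x₂} → Outside x₁ → Dominates x₁ → Outside x₂ → Dominates x₂ →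
                                  x₂ ≢ x₁ → RomanBondageAtMost G 4 Δ+δ-1
    bondage-with-two-dominators {x₁} {x₂} O₁ dom₁ O₂ dom₂ x₂≢x₁ =
      cut-bondage x₁ (D ∖ x₁) D∖x₁⊆N[x₁] covers 5≤n v-min budget
      where
      D : Fin n → Bool
      D x = does (dominator? x)
      D-intro : ∀ {x} → Outside x → Dominates x → D x ≡ true
      D-intro {x} Ox dom = dec-true (dominator? x) (Ox , dom)
      D∖x₁⊆N[x₁] : ∀ j → (D ∖ x₁) j ≡ true → adj G x₁ j ≡ true
      D∖x₁⊆N[x₁] j D∖x₁j with Dj , j≢x₁ ← ∖-elim {p = D} D∖x₁j =
        dom₁ j (proj₁ (witness (dominator? j) Dj)) j≢x₁
      covers : Covers x₁ (D ∖ x₁)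
      covers {x} Ox dom = case x ≟ x₁ of λ where
        (yes x≡x₁) → x₂ , O₂ , inj₁ (x≡x₁ , ∖-intro {p = D} (D-intro O₂ dom₂) x₂≢x₁)
        (no  x≢x₁) → x₁ , O₁ , inj₂ (refl , ∖-intro {p = D} (D-intro Ox dom) x≢x₁)
      N[c]∪D<n : count (λ j → adj G c j ∨ D j) < n
      N[c]∪D<n = count<n (λ j → adj G c j ∨ D j) {c}
        (cong₂ _∨_ (irrefl G c) (dec-false (dominator? c) (λ (Oc , _) → proj₂ Oc refl)))
      N[c]∩D≡∅ : ∀ j → adj G c j ≡ true → D j ≡ false
      N[c]∩D≡∅ j cj = ¬-not λ Dj →
        case trans (sym cj) (dominator-≁-c (proj₂ (witness (dominator? j) Dj))) of λ ()
      -- N(c) and D are disjoint and miss c, while x₁ is adjacent to all but v, c and x₁.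
      budget : count N[c]∖v + count (D ∖ x₁) ≤ maxDegree G
      budget = +-cancelʳ-≤ 3 _ _ (begin
        |B| + |T| + 3                           ≡⟨ +3≡ |B| |T| ⟩
        suc ((|B| + 1) + (|T| + 1))             ≡⟨ cong (λ k → suc (k + (|T| + 1))) |B|+1≡deg-c ⟩
        suc (degree G c + (|T| + 1))            ≡⟨ cong (λ k → suc (degree G c + k)) |T|+1≡|D| ⟩
        suc (degree G c + count D)              ≡⟨ cong suc (count-∨-disjoint (adj G c) D N[c]∩D≡∅) ⟨
        suc (count (λ j → adj G c j ∨ D j))     ≤⟨ N[c]∪D<n ⟩
        n                                       ≤⟨ n≤degree+3 dom₁ ⟩
        degree G x₁ + 3                         ≤⟨ +-monoˡ-≤ 3 (degree≤maxDegree G x₁) ⟩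
        maxDegree G + 3                         ∎)
        where
        open ≤-Reasoning
        |B| |T| : ℕ
        |B| = count N[c]∖v
        |T| = count (D ∖ x₁)
        |B|+1≡deg-c : |B| + 1 ≡ degree G c
        |B|+1≡deg-c = count-∖ (adj G c) (adj-sym G vc)
        |T|+1≡|D| : |T| + 1 ≡ count D
        |T|+1≡|D| = count-∖ D (D-intro O₁ dom₁)
        +3≡ : ∀ a b → a + b + 3 ≡ suc ((a + 1) + (b + 1))
        +3≡ = solve-∀

    bondage : RomanBondageAtMost G 4 Δ+δ-1
    bondage with any? dominator?
    ... | no ∄dominator = bondage-without-dominator (λ Ox dom → ∄dominator (_ , Ox , dom))
    ... | yes (x₁ , O₁ , dom₁) with any? (λ x → dominator? x ×-dec ¬? (x ≟ x₁))
    ...   | yes (x₂ , (O₂ , dom₂) , x₂≢x₁) = bondage-with-two-dominators O₁ dom₁ O₂ dom₂ x₂≢x₁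
    ...   | no ∄other = bondage-with-unique-dominator O₁ dom₁ unique
      where
      unique : ∀ {x} → Outside x → Dominates x → x ≡ x₁
      unique {x} Ox dom = decidable-stable (x ≟ x₁) (λ x≢x₁ → ∄other (x , (Ox , dom) , x≢x₁))

theorem14 : ∀ (n : ℕ) (G : Graph n) → 4 ≤ n → Connected G → RomanDomNumber G 4 →
    RomanBondageAtMost G 4 (maxDegree G + minDegree G ∸ 1)
theorem14 n G 4≤n connected γR≡4
  with v₀ , _ ← ∃∉ [] (≤-trans (s≤s z≤n) 4≤n)
  with v , v-min ← minDegree-attained G v₀
  with c , vc ← ∃-neighbour G (≤-trans (s≤s (s≤s z≤n)) 4≤n) connected v
  = IsolateEdge.bondage G vc sparse 5≤n v-min
  where
  sparse : ∀ x → degree G x + 3 ≤ n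
  sparse x = subst (_≤ n) (+-comm 3 (degree G x)) (s≤s⁻¹ (γR+degree≤n+1 G γR≡4 x))
  5≤n : 5 ≤ n
  5≤n = sparse-connected⇒5≤n G 4≤n connected sparse
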